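{- For all terms $s\in U$ and all terms $t$: (1) if $s=_{\mathrm{AC}}t$ then $\pi(s)=_{\mathrm{AC}}\pi(t)$; (2) if $s\to_{\mathcal{H}_2}t$ then $\pi(s)=_{\mathrm{AC}}\pi(t)$; (3) if $s\to_{\mathcal{H}_3}t$ then $\pi(s)\to_{\mathcal{R}_n/\mathrm{AC}}\pi(t)$, where $s=\mathsf{B}(\mathsf{s}^n(\mathsf{0}),s')$ for some $n\ge0$ and some term $s'$.
   Context: Terms are built from variables and: constants $\mathsf{h},\mathsf{0}$; unary $\mathsf{I},\mathsf{E},\mathsf{s}$; binary $\mathsf{A},\mathsf{B},\mathsf{C},\mathsf{D}$ and binary $\mid$ (infix); $=_{\mathrm{AC}}$ is the congruence generated by associativity and commutativity of $\mid$. For a set $\mathcal{R}$ of rules, $\to_{\mathcal{R}}$ is its closure under substitutions and contexts and $\to_{\mathcal{R}/\mathrm{AC}}={=_{\mathrm{AC}}}\cdot{\to_{\mathcal{R}}}\cdot{=_{\mathrm{AC}}}$. The rules of $\mathcal{H}$ are numbered: (1) $\mathsf{A}(n,\mathsf{I}(\mathsf{h}))\to\mathsf{A}(\mathsf{s}(n),\mathsf{h})$; (2) $\mathsf{A}(n,\mathsf{I}(\mathsf{h}\mid x))\to\mathsf{A}(\mathsf{s}(n),\mathsf{I}(x))$; (3) $\mathsf{A}(n,\mathsf{I}(x))\to\mathsf{B}(n,\mathsf{D}(\mathsf{s}(n),\mathsf{I}(x)))$; (4) $\mathsf{C}(\mathsf{0},x)\to\mathsf{E}(x)$; (5) $\mathsf{C}(\mathsf{s}(n),x)\to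 x\mid\mathsf{C}(n,x)$; (6) $\mathsf{I}(\mathsf{E}(x)\mid y)\to\mathsf{E}(\mathsf{I}(x\mid y))$; (7) $\mathsf{I}(\mathsf{E}(x))\to\mathsf{E}(\mathsf{I}(x))$; (8) $\mathsf{D}(n,\mathsf{I}(\mathsf{I}(x)))\to\mathsf{I}(\mathsf{D}(n,\mathsf{I}(x)))$; (9) $\mathsf{D}(n,\mathsf{I}(\mathsf{I}(x)\mid y))\to\mathsf{I}(\mathsf{D}(n,\mathsf{I}(x))\mid y)$; (10) $\mathsf{D}(n,\mathsf{I}(\mathsf{I}(\mathsf{h}\mid x)\mid y))\to\mathsf{I}(\mathsf{C}(n,\mathsf{I}(x))\mid y)$; (11) $\mathsf{D}(n,\mathsf{I}(\mathsf{I}(\mathsf{h}\mid x)))\to\mathsf{I}(\mathsf{C}(n,\mathsf{I}(x)))$; (12) $\mathsf{D}(n,\mathsf{I}(\mathsf{I}(\mathsf{h})\mid y))\to\mathsf{I}(\mathsf{C}(n,\mathsf{h})\mid y)$; (13) $\mathsf{D}(n,\mathsf{I}(\mathsf{I}(\mathsf{h})))\to\mathsf{I}(\mathsf{C}(n,\mathsf{h}))$; (14) $\mathsf{B}(n,\mathsf{E}(x))\to\mathsf{A}(\mathsf{s}(n),x)$. $\mathcal{H}_2$ consists of rules 3,4,5,6,7,8,9,14 and $\mathcal{H}_3$ of rules 10,11,12,13. $u^1=u$, $u^k=u^{k-1}\mid u$ ($k>1$). For $n\in\mathbb{N}$, $\mathcal{R}_n$ consists of $\mathsf{I}(\mathsf{I}(\mathsf{h}))\to\mathsf{I}(\mathsf{h}^{n+2})$,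 $\mathsf{I}(\mathsf{I}(\mathsf{h}\mid x))\to\mathsf{I}(\mathsf{I}(x)^{n+2})$, $\mathsf{I}(\mathsf{I}(\mathsf{h})\mid y)\to\mathsf{I}(\mathsf{h}^{n+2}\mid y)$, $\mathsf{I}(\mathsf{I}(\mathsf{h}\mid x)\mid y)\to\mathsf{I}(\mathsf{I}(x)^{n+2}\mid y)$. $\mathcal{T}_{\mathcal{H}}$: ground terms over $\{\mathsf{h},\mathsf{I},\mid\}$; $\mathcal{C}_{\mathcal{H}}$: ground contexts over $\{\mathsf{h},\mathsf{I},\mid\}$ with exactly one hole. $\overline{n}=\mathsf{s}^n(\mathsf{0})$. $U$ is the set of all terms $\mathsf{A}(\overline{n},t)$, $\mathsf{B}(\overline{n},C[\mathsf{C}(\overline{m},t)])$, $\mathsf{B}(\overline{n},C[\mathsf{D}(\overline{n+1},t)])$, $\mathsf{B}(\overline{n},C[\mathsf{E}(t)])$ ($n,m\in\mathbb{N}$, $t\in\mathcal{T}_{\mathcal{H}}$, $C\in\mathcal{C}_{\mathcal{H}}$); $U$ is closed under $\mathcal{H}$-steps and AC-steps. $V$ is the union of $U$, $\mathcal{T}_{\mathcal{H}}$ and all $C[\mathsf{C}(\overline{n},t)]$, $C[\mathsf{D}(\overline{n},t)]$, $C[\mathsf{E}(t)]$ ($n\in\mathbb{N}$, $t\in\mathcal{T}_{\mathcal{H}}$, $C\in\mathcal{C}_{\mathcal{H}}$). $\pi:V\to\mathcal{T}_{\mathcal{H}}$ is given recursively by $\pi(\mathsf{h})=\mathsf{h}$,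 $\pi(\mathsf{I}(u))=\mathsf{I}(\pi(u))$, $\pi(u\mid v)=\pi(u)\mid\pi(v)$, $\pi(\mathsf{A}(\overline{n},u))=\pi(\mathsf{D}(\overline{n},u))=\pi(\mathsf{E}(u))=u$, $\pi(\mathsf{B}(\overline{n},u))=\pi(u)$, $\pi(\mathsf{C}(\overline{n},u))=u^{n+1}$. -}

module Defs where

open import Data.Nat using (ℕ; zero; suc)
open import Data.Product using (Σ; ∃; _×_; _,_)
open import Relation.Binary.PropositionalEquality using (_≡_)

infixl 6 _∣_

data Term : Set where
  var : ℕ → Term
  h 𝟘 : Term
  I E S : Term → Term
  A B C D : Term → Term → Term
  _∣_ : Term → Term → Term

Subst : Set
Subst = ℕ → Term

_[_] : Term → Subst → Term
var i [ σ ] = σ i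
h [ σ ] = h
𝟘 [ σ ] = 𝟘
I t [ σ ] = I (t [ σ ])
E t [ σ ] = E (t [ σ ])
S t [ σ ] = S (t [ σ ])
A t u [ σ ] = A (t [ σ ]) (u [ σ ])
B t u [ σ ] = B (t [ σ ]) (u [ σ ])
C t u [ σ ] = C (t [ σ ]) (u [ σ ])
D t u [ σ ] = D (t [ σ ]) (u [ σ ])
(t ∣ u) [ σ ] = (t [ σ ]) ∣ (u [ σ ])

num : ℕ → Term
num zero = 𝟘
num (suc n) = S (num n)

-- u^k as in the paper, indexed from 1:  pow u k = u^(k+1),
-- so pow u 0 = u and pow u (suc k) = pow u k ∣ u.
pow : Term → ℕ → Term
pow u zero = u
pow u (suc k) = pow u k ∣ u

data _=AC_ : Term → Term → Set where
  ac-refl  : ∀ {t} → t =AC t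
  ac-sym   : ∀ {t u} → t =AC u → u =AC t
  ac-trans : ∀ {t u v} → t =AC u → u =AC v → t =AC v
  ac-assoc : ∀ {x y z} → ((x ∣ y) ∣ z) =AC (x ∣ (y ∣ z))
  ac-comm  : ∀ {x y} → (x ∣ y) =AC (y ∣ x)
  ac-I  : ∀ {t t'} → t =AC t' → I t =AC I t'
  ac-E  : ∀ {t t'} → t =AC t' → E t =AC E t'
  ac-S  : ∀ {t t'} → t =AC t' → S t =AC S t'
  ac-A  : ∀ {t t' u u'} → t =AC t' → u =AC u' → A t u =AC A t' u'
  ac-B  : ∀ {t t' u u'} → t =AC t' → u =AC u' → B t u =AC B t' u'
  ac-C  : ∀ {t t' u u'} → t =AC t' → u =AC u' → C t u =AC C t' u'
  ac-D  : ∀ {t t' u u'} → t =AC t' → u =AC u' → D t u =AC D t' u'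
  ac-∣  : ∀ {t t' u u'} → t =AC t' → u =AC u' → (t ∣ u) =AC (t' ∣ u')

Rules : Set₁
Rules = Term → Term → Set

data Step (R : Rules) : Term → Term → Set where
  root : ∀ {l r} (σ : Subst) → R l r → Step R (l [ σ ]) (r [ σ ])
  inI  : ∀ {t t'} → Step R t t' → Step R (I t) (I t')
  inE  : ∀ {t t'} → Step R t t' → Step R (E t) (E t')
  inS  : ∀ {t t'} → Step R t t' → Step R (S t) (S t')
  inA₁ : ∀ {t t' u} → Step R t t' → Step R (A t u) (A t' u)
  inA₂ : ∀ {t u u'} → Step R u u' → Step R (A t u) (A t u')
  inB₁ : ∀ {t t' u} → Step R t t' → Step R (B t u) (B t' u)
  inB₂ : ∀ {t u u'} → Step R u u' → Step R (B t u) (B t u')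
  inC₁ : ∀ {t t' u} → Step R t t' → Step R (C t u) (C t' u)
  inC₂ : ∀ {t u u'} → Step R u u' → Step R (C t u) (C t u')
  inD₁ : ∀ {t t' u} → Step R t t' → Step R (D t u) (D t' u)
  inD₂ : ∀ {t u u'} → Step R u u' → Step R (D t u) (D t u')
  in∣₁ : ∀ {t t' u} → Step R t t' → Step R (t ∣ u) (t' ∣ u)
  in∣₂ : ∀ {t u u'} → Step R u u' → Step R (t ∣ u) (t ∣ u')

StepModAC : Rules → Term → Term → Set
StepModAC R s t = ∃ λ s' → ∃ λ t' → (s =AC s') × Step R s' t' × (t' =AC t)

vn vx vy : Term
vn = var 0
vx = var 1
vy = var 2

data H₂ : Rules where
  r3  : H₂ (A vn (I vx)) (B vn (D (S vn) (I vx)))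
  r4  : H₂ (C 𝟘 vx) (E vx)
  r5  : H₂ (C (S vn) vx) (vx ∣ C vn vx)
  r6  : H₂ (I (E vx ∣ vy)) (E (I (vx ∣ vy)))
  r7  : H₂ (I (E vx)) (E (I vx))
  r8  : H₂ (D vn (I (I vx))) (I (D vn (I vx)))
  r9  : H₂ (D vn (I (I vx ∣ vy))) (I (D vn (I vx) ∣ vy))
  r14 : H₂ (B vn (E vx)) (A (S vn) vx)

data H₃ : Rules where
  r10 : H₃ (D vn (I (I (h ∣ vx) ∣ vy))) (I (C vn (I vx) ∣ vy))
  r11 : H₃ (D vn (I (I (h ∣ vx)))) (I (C vn (I vx)))
  r12 : H₃ (D vn (I (I h ∣ vy))) (I (C vn h ∣ vy))
  r13 : H₃ (D vn (I (I h))) (I (C vn h))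

-- R_n  (u^(n+2) = pow u (suc n))
data ℛ (n : ℕ) : Rules where
  q1 : ℛ n (I (I h)) (I (pow h (suc n)))
  q2 : ℛ n (I (I (h ∣ vx))) (I (pow (I vx) (suc n)))
  q3 : ℛ n (I (I h ∣ vy)) (I (pow h (suc n) ∣ vy))
  q4 : ℛ n (I (I (h ∣ vx) ∣ vy)) (I (pow (I vx) (suc n) ∣ vy))

data TH : Term → Set where
  th-h : TH h
  th-I : ∀ {t} → TH t → TH (I t)
  th-∣ : ∀ {t u} → TH t → TH u → TH (t ∣ u)

-- InCtx P u : u = C[v] for some C ∈ C_H (ground context over {h,I,∣}
-- with exactly one hole) and some v with P v
data InCtx (P : Term → Set) : Term → Set where
  here : ∀ {v} → P v → InCtx P v
  cI   : ∀ {u} → InCtx P u → InCtx P (I u)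
  cL   : ∀ {u t} → InCtx P u → TH t → InCtx P (u ∣ t)
  cR   : ∀ {u t} → TH t → InCtx P u → InCtx P (t ∣ u)

data InU : Term → Set where
  uA : ∀ {n t} → TH t → InU (A (num n) t)
  uC : ∀ {n u} → InCtx (λ v → ∃ λ m → ∃ λ t → TH t × (v ≡ C (num m) t)) u
       → InU (B (num n) u)
  uD : ∀ {n u} → InCtx (λ v → ∃ λ t → TH t × (v ≡ D (num (suc n)) t)) u
       → InU (B (num n) u)
  uE : ∀ {n u} → InCtx (λ v → ∃ λ t → TH t × (v ≡ E t)) u
       → InU (B (num n) u)

val : Term → ℕ
val (S t) = suc (val t)
val _ = zero

-- π, made total; agrees with the paper's π on V (on terms outside V the
-- value is irrelevant junk).
π : Term → Term
π h = h
π (I u) = I (π u)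
π (u ∣ v) = π u ∣ π v
π (A _ u) = u
π (D _ u) = u
π (E u) = u
π (B _ u) = π u
π (C m u) = pow u (val m)
π (var i) = var i
π 𝟘 = 𝟘
π (S u) = S u

{-# OPTIONS --safe #-}
-- π forgets the control symbols A, B, D, E and unfolds C(m̄, t) into t^(m+1).
-- In a term of U every control symbol sits directly above numerals and ground
-- terms of T_H, which are in normal form, so a rewrite step can only fire at
-- (or just above) such a symbol. An H₂ step there is invisible after π, except
-- rule 5, which becomes the commutation t ∣ t^m =AC t^m ∣ t. An H₃ step fires
-- at D(s^(n+1)(0), t) inside B(s^n(0), _), and π turns it into the R_n step
-- whose right-hand side has the n+2 copies produced by C(s^(n+1)(0), _).
module Submission where

open import Defs
open import Data.Nat using (ℕ; zero; suc)
open import Data.Product using (_×_; _,_; ∃)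
open import Relation.Nullary using (¬_)
open import Relation.Binary.PropositionalEquality
  using (_≡_; refl; sym; trans; cong; cong₂; subst)

≡⇒=AC : ∀ {a b} → a ≡ b → a =AC b
≡⇒=AC refl = ac-refl

pow-cong : ∀ {a b} k → a =AC b → pow a k =AC pow b k
pow-cong zero    a≈b = a≈b
pow-cong (suc k) a≈b = ac-∣ (pow-cong k a≈b) a≈b

pow-[] : ∀ u k σ → pow u k [ σ ] ≡ pow (u [ σ ]) k
pow-[] u zero    σ = refl
pow-[] u (suc k) σ = cong (_∣ (u [ σ ])) (pow-[] u k σ)

val-cong : ∀ {a b} → a =AC b → val a ≡ val b
val-cong ac-refl             = refl
val-cong (ac-sym a≈b)        = sym (val-cong a≈b)
val-cong (ac-trans a≈b b≈c)  = trans (val-cong a≈b) (val-cong b≈c)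
val-cong ac-assoc            = refl
val-cong ac-comm             = refl
val-cong (ac-I _)            = refl
val-cong (ac-E _)            = refl
val-cong (ac-S a≈b)          = cong suc (val-cong a≈b)
val-cong (ac-A _ _)          = refl
val-cong (ac-B _ _)          = refl
val-cong (ac-C _ _)          = refl
val-cong (ac-D _ _)          = refl
val-cong (ac-∣ _ _)          = refl

π-cong : ∀ {a b} → a =AC b → π a =AC π b
π-cong ac-refl            = ac-refl
π-cong (ac-sym a≈b)       = ac-sym (π-cong a≈b)
π-cong (ac-trans a≈b b≈c) = ac-trans (π-cong a≈b) (π-cong b≈c)
π-cong ac-assoc           = ac-assoc
π-cong ac-comm            = ac-comm
π-cong (ac-I a≈b)         = ac-I (π-cong a≈b)
π-cong (ac-E a≈b)         = a≈b
π-cong (ac-S a≈b)         = ac-S a≈b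
π-cong (ac-A _ a≈b)       = a≈b
π-cong (ac-B _ a≈b)       = π-cong a≈b
π-cong (ac-C {m} {m′} m≈m′ a≈b) =
  subst (λ k → pow _ k =AC pow _ (val m′)) (sym (val-cong m≈m′)) (pow-cong (val m′) a≈b)
π-cong (ac-D _ a≈b)       = a≈b
π-cong (ac-∣ a≈b c≈d)     = ac-∣ (π-cong a≈b) (π-cong c≈d)

π-TH : ∀ {t} → TH t → π t ≡ t
π-TH th-h       = refl
π-TH (th-I t)   = cong I (π-TH t)
π-TH (th-∣ t u) = cong₂ _∣_ (π-TH t) (π-TH u)

root-≡ : ∀ {R l r t} σ → R l r → r [ σ ] ≡ t → Step R (l [ σ ]) t
root-≡ σ ρ refl = root σ ρ

Step⇒StepModAC : ∀ {R s t} → Step R s t → StepModAC R s t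
Step⇒StepModAC s→t = _ , _ , ac-refl , s→t , ac-refl

data Inert : Term → Set where
  h   : Inert h
  𝟘   : Inert 𝟘
  I   : ∀ {t} → Inert t → Inert (I t)
  S   : ∀ {t} → Inert t → Inert (S t)
  _∣_ : ∀ {t u} → Inert t → Inert u → Inert (t ∣ u)

TH⇒Inert : ∀ {t} → TH t → Inert t
TH⇒Inert th-h       = h
TH⇒Inert (th-I t)   = I (TH⇒Inert t)
TH⇒Inert (th-∣ t u) = TH⇒Inert t ∣ TH⇒Inert u

num-Inert : ∀ n → Inert (num n)
num-Inert zero    = 𝟘
num-Inert (suc n) = S (num-Inert n)

val-num : ∀ n → val (num n) ≡ n
val-num zero    = refl
val-num (suc n) = cong suc (val-num n)

Inert-normal : ∀ {R} → (∀ {l r} σ → R l r → ¬ Inert (l [ σ ])) →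
               ∀ {t t′} → Inert t → ¬ Step R t t′
Inert-normal lhs-active i       (root σ ρ) = lhs-active σ ρ i
Inert-normal lhs-active (I i)   (inI s)    = Inert-normal lhs-active i s
Inert-normal lhs-active (S i)   (inS s)    = Inert-normal lhs-active i s
Inert-normal lhs-active (i ∣ _) (in∣₁ s)   = Inert-normal lhs-active i s
Inert-normal lhs-active (_ ∣ j) (in∣₂ s)   = Inert-normal lhs-active j s

H₂-lhs-not-Inert : ∀ {l r} σ → H₂ l r → ¬ Inert (l [ σ ])
H₂-lhs-not-Inert σ r3  ()
H₂-lhs-not-Inert σ r4  ()
H₂-lhs-not-Inert σ r5  ()
H₂-lhs-not-Inert σ r6  (I (() ∣ _))
H₂-lhs-not-Inert σ r7  (I ())
H₂-lhs-not-Inert σ r8  ()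
H₂-lhs-not-Inert σ r9  ()
H₂-lhs-not-Inert σ r14 ()

H₃-lhs-not-Inert : ∀ {l r} σ → H₃ l r → ¬ Inert (l [ σ ])
H₃-lhs-not-Inert σ r10 ()
H₃-lhs-not-Inert σ r11 ()
H₃-lhs-not-Inert σ r12 ()
H₃-lhs-not-Inert σ r13 ()

Inert-H₂-normal : ∀ {t t′} → Inert t → ¬ Step H₂ t t′
Inert-H₂-normal = Inert-normal H₂-lhs-not-Inert

Inert-H₃-normal : ∀ {t t′} → Inert t → ¬ Step H₃ t t′
Inert-H₃-normal = Inert-normal H₃-lhs-not-Inert

-- k is the value of the numeral of the enclosing B.
data Hole (k : ℕ) : Term → Set where
  C : ∀ {m t} → Inert m → TH t → Hole k (C m t)
  D : ∀ {m t} → Inert m → val m ≡ suc k → TH t → Hole k (D m t)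
  E : ∀ {t} → TH t → Hole k (E t)

-- U with the numerals replaced by arbitrary inert terms, so that an index
-- num n never has to be unified with the left-hand side of a rule.
data InU′ : Term → Set where
  A : ∀ {m t} → Inert m → TH t → InU′ (A m t)
  B : ∀ {m u} → Inert m → InCtx (Hole (val m)) u → InU′ (B m u)

InCtx-map : ∀ {P Q : Term → Set} → (∀ {v} → P v → Q v) → ∀ {u} → InCtx P u → InCtx Q u
InCtx-map f (here p)   = here (f p)
InCtx-map f (cI c)     = cI (InCtx-map f c)
InCtx-map f (cL c t)   = cL (InCtx-map f c) t
InCtx-map f (cR t c)   = cR t (InCtx-map f c)

InU⇒InU′ : ∀ {s} → InU s → InU′ s
InU⇒InU′ (uA {n} t) = A (num-Inert n) t
InU⇒InU′ (uC {n} c) = B (num-Inert n) (InCtx-map C-hole c)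
  where
  C-hole : ∀ {v} → ∃ (λ m → ∃ λ t → TH t × v ≡ C (num m) t) → Hole (val (num n)) v
  C-hole (m , _ , t , refl) = C (num-Inert m) t
InU⇒InU′ (uD {n} c) = B (num-Inert n) (InCtx-map D-hole c)
  where
  D-hole : ∀ {v} → ∃ (λ t → TH t × v ≡ D (num (suc n)) t) → Hole (val (num n)) v
  D-hole (_ , t , refl) = D (num-Inert (suc n)) refl t
InU⇒InU′ (uE {n} c) = B (num-Inert n) (InCtx-map E-hole c)
  where
  E-hole : ∀ {v} → ∃ (λ t → TH t × v ≡ E t) → Hole (val (num n)) v
  E-hole (_ , t , refl) = E t

π-H₂-root : ∀ {k l r} σ → H₂ l r → InCtx (Hole k) (l [ σ ]) → π (l [ σ ]) =AC π (r [ σ ])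
π-H₂-root σ r4 (here (C _ _))   = ac-refl
π-H₂-root σ r5 (here (C _ t))   = ac-trans ac-comm (ac-∣ (≡⇒=AC (sym (π-TH t))) ac-refl)
π-H₂-root σ r8 (here (D _ _ _)) = ac-refl
π-H₂-root σ r9 (here (D _ _ (th-I (th-∣ _ y)))) = ac-I (ac-∣ ac-refl (≡⇒=AC (sym (π-TH y))))
π-H₂-root σ r6 (cI (cL (here (E _)) y)) = ac-I (ac-∣ ac-refl (≡⇒=AC (π-TH y)))
π-H₂-root σ r6 (cI (cR () _))
π-H₂-root σ r7 (cI (here (E _))) = ac-refl
π-H₂-root σ r3 (here ())
π-H₂-root σ r14 (here ())

π-H₂-step-InCtx : ∀ {k u u′} → Step H₂ u u′ → InCtx (Hole k) u → π u =AC π u′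
π-H₂-step-InCtx (root σ ρ) c = π-H₂-root σ ρ c
π-H₂-step-InCtx (inI s)  (cI c)   = ac-I (π-H₂-step-InCtx s c)
π-H₂-step-InCtx (in∣₁ s) (cL c _) = ac-∣ (π-H₂-step-InCtx s c) ac-refl
π-H₂-step-InCtx (in∣₂ s) (cR _ c) = ac-∣ ac-refl (π-H₂-step-InCtx s c)
π-H₂-step-InCtx (in∣₁ s) (cR t _) with () ← Inert-H₂-normal (TH⇒Inert t) s
π-H₂-step-InCtx (in∣₂ s) (cL _ t) with () ← Inert-H₂-normal (TH⇒Inert t) s
π-H₂-step-InCtx (inC₁ s) (here (C m _))   with () ← Inert-H₂-normal m s
π-H₂-step-InCtx (inC₂ s) (here (C _ t))   with () ← Inert-H₂-normal (TH⇒Inert t) s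
π-H₂-step-InCtx (inD₁ s) (here (D m _ _)) with () ← Inert-H₂-normal m s
π-H₂-step-InCtx (inD₂ s) (here (D _ _ t)) with () ← Inert-H₂-normal (TH⇒Inert t) s
π-H₂-step-InCtx (inE s)  (here (E t))     with () ← Inert-H₂-normal (TH⇒Inert t) s
π-H₂-step-InCtx (inS _)  (here ())
π-H₂-step-InCtx (inA₁ _) (here ())
π-H₂-step-InCtx (inA₂ _) (here ())
π-H₂-step-InCtx (inB₁ _) (here ())
π-H₂-step-InCtx (inB₂ _) (here ())

π-H₂-step : ∀ {s t} → Step H₂ s t → InU′ s → π s =AC π t
π-H₂-step (root σ r3)  (A _ _) = ac-refl
π-H₂-step (root σ r14) (B _ _) = ac-refl
π-H₂-step (root σ r4)  ()
π-H₂-step (root σ r5)  ()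
π-H₂-step (root σ r6)  ()
π-H₂-step (root σ r7)  ()
π-H₂-step (root σ r8)  ()
π-H₂-step (root σ r9)  ()
π-H₂-step (inA₁ s) (A m _) with () ← Inert-H₂-normal m s
π-H₂-step (inA₂ s) (A _ t) with () ← Inert-H₂-normal (TH⇒Inert t) s
π-H₂-step (inB₁ s) (B m _) with () ← Inert-H₂-normal m s
π-H₂-step (inB₂ s) (B _ c) = π-H₂-step-InCtx s c

π-H₃-root : ∀ {k l r} σ → H₃ l r → InCtx (Hole k) (l [ σ ]) → Step (ℛ k) (π (l [ σ ])) (π (r [ σ ]))
π-H₃-root {k} σ r10 (here (D _ m≡ (th-I (th-∣ _ y)))) rewrite m≡ =
  root-≡ σ q4 (cong₂ (λ p z → I (p ∣ z)) (pow-[] (I vx) (suc k) σ) (sym (π-TH y)))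
π-H₃-root {k} σ r11 (here (D _ m≡ _)) rewrite m≡ =
  root-≡ σ q2 (cong I (pow-[] (I vx) (suc k) σ))
π-H₃-root {k} σ r12 (here (D _ m≡ (th-I (th-∣ _ y)))) rewrite m≡ =
  root-≡ σ q3 (cong₂ (λ p z → I (p ∣ z)) (pow-[] h (suc k) σ) (sym (π-TH y)))
π-H₃-root {k} σ r13 (here (D _ m≡ _)) rewrite m≡ =
  root-≡ σ q1 (cong I (pow-[] h (suc k) σ))

π-H₃-step-InCtx : ∀ {k u u′} → Step H₃ u u′ → InCtx (Hole k) u → Step (ℛ k) (π u) (π u′)
π-H₃-step-InCtx (root σ ρ) c = π-H₃-root σ ρ c
π-H₃-step-InCtx (inI s)  (cI c)   = inI (π-H₃-step-InCtx s c)
π-H₃-step-InCtx (in∣₁ s) (cL c _) = in∣₁ (π-H₃-step-InCtx s c)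
π-H₃-step-InCtx (in∣₂ s) (cR _ c) = in∣₂ (π-H₃-step-InCtx s c)
π-H₃-step-InCtx (in∣₁ s) (cR t _) with () ← Inert-H₃-normal (TH⇒Inert t) s
π-H₃-step-InCtx (in∣₂ s) (cL _ t) with () ← Inert-H₃-normal (TH⇒Inert t) s
π-H₃-step-InCtx (inC₁ s) (here (C m _))   with () ← Inert-H₃-normal m s
π-H₃-step-InCtx (inC₂ s) (here (C _ t))   with () ← Inert-H₃-normal (TH⇒Inert t) s
π-H₃-step-InCtx (inD₁ s) (here (D m _ _)) with () ← Inert-H₃-normal m s
π-H₃-step-InCtx (inD₂ s) (here (D _ _ t)) with () ← Inert-H₃-normal (TH⇒Inert t) s
π-H₃-step-InCtx (inE s)  (here (E t))     with () ← Inert-H₃-normal (TH⇒Inert t) s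
π-H₃-step-InCtx (inS _)  (here ())
π-H₃-step-InCtx (inA₁ _) (here ())
π-H₃-step-InCtx (inA₂ _) (here ())
π-H₃-step-InCtx (inB₁ _) (here ())
π-H₃-step-InCtx (inB₂ _) (here ())

π-H₃-step : ∀ {s t n s′} → Step H₃ s t → InU′ s → s ≡ B (num n) s′ →
            StepModAC (ℛ n) (π s) (π t)
π-H₃-step (root σ r10) ()
π-H₃-step (root σ r11) ()
π-H₃-step (root σ r12) ()
π-H₃-step (root σ r13) ()
π-H₃-step (inB₁ s) (B m _) _ with () ← Inert-H₃-normal m s
π-H₃-step {n = n} (inB₂ s) (B _ c) refl =
  Step⇒StepModAC (subst (λ k → Step (ℛ k) _ _) (val-num n) (π-H₃-step-InCtx s c))

lemma3p16 : ∀ (s t : Term) → InU s →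
    ((s =AC t) → (π s =AC π t))
    × (Step H₂ s t → (π s =AC π t))
    × (Step H₃ s t → ∀ (n : ℕ) (s' : Term) → s ≡ B (num n) s' →
         StepModAC (ℛ n) (π s) (π t))
lemma3p16 s t s∈U = π-cong , (λ s→t → π-H₂-step s→t s∈U′) , λ s→t _ _ → π-H₃-step s→t s∈U′
  where
  s∈U′ : InU′ s
  s∈U′ = InU⇒InU′ s∈U
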